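{- Let $S=\{p,q\}$ be a set of two distinct primes and let $(a,b,c,d)$ be an $S$-Diophantine quadruple with $a<b<c<d$. Then $ab\ge 3$ and $c\ge 5$.
   Context: For a finite set $S$ of primes, a positive integer is an $S$-unit if all its prime factors lie in $S$. A quadruple $(a,b,c,d)$ of positive, pairwise distinct integers is an $S$-Diophantine quadruple if the product of any two distinct entries plus $1$ is an $S$-unit. -}

module Defs where

open import Data.Nat using (ℕ; _*_; _+_; _<_; NonZero)
open import Data.Nat.Divisibility using (_∣_)
open import Data.Nat.Primality using (Prime)
open import Data.Product using (_×_)
open import Data.Sum using (_⊎_)
open import Relation.Binary.PropositionalEquality using (_≡_)

IsSUnit₂ : ℕ → ℕ → ℕ → Set
IsSUnit₂ p q n = 0 < n × (∀ r → Prime r → r ∣ n → r ≡ p ⊎ r ≡ q)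

IsSDiophantineQuadruple₂ : ℕ → ℕ → ℕ → ℕ → ℕ → ℕ → Set
IsSDiophantineQuadruple₂ p q a b c d =
  (0 < a × 0 < b × 0 < c × 0 < d) ×
  ((a ≢ b) × (a ≢ c) × (a ≢ d) × (b ≢ c) × (b ≢ d) × (c ≢ d)) ×
  (IsSUnit₂ p q (a * b + 1) × IsSUnit₂ p q (a * c + 1) × IsSUnit₂ p q (a * d + 1) ×
   IsSUnit₂ p q (b * c + 1) × IsSUnit₂ p q (b * d + 1) × IsSUnit₂ p q (c * d + 1))
  where open import Relation.Binary.PropositionalEquality using (_≢_)

{-# OPTIONS --safe #-}
-- If a * b ≤ 2 then (a, b) = (1, 2), and 3 = a * b + 1 forces S = {3, r}. For x ∈ {c, d} the
-- coprime S-units x + 1 and 2x + 1 are then a power of 3 and a power of r, in some order.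
-- By the identity βγ(cd + 1) + (βc + 1) + (γd + 1) = (βc + 1)(γd + 1) + (βγ + 1), a common
-- divisor of βc + 1, γd + 1 and cd + 1 divides βγ + 1 ∈ {2, 3, 5}. In each configuration this
-- pins down the prime t of which cd + 1 is a power as t = βγ + 1; since βc + 1, γd + 1 and
-- cd + 1 are powers of t exceeding t, the same identity gives t² ∣ t.
-- If a * b ≥ 3 but c ≤ 4, then (b, c) = (3, 4) and a ∈ {1, 2}, and a * b + 1, a * c + 1 and
-- b * c + 1 have three distinct prime factors between them.

module Submission where

open import Defs
open import Data.Nat using (ℕ; _*_; _<_; _≥_)
open import Data.Nat.Primality using (Prime)
open import Data.Product using (_×_)
open import Relation.Binary.PropositionalEquality using (_≢_)

open import Data.Nat using (suc; _+_; _≤_; z≤n; s≤s; _≤?_; NonZero; >-nonZero; nonTrivial⇒n>1)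
open import Data.Nat.Properties
open import Data.Nat.Divisibility
open import Data.Nat.Coprimality using (Coprime)
open import Data.Nat.Primality using (prime?; prime⇒nonZero; prime⇒nonTrivial; prime⇒irreducible)
open import Data.Nat.Primality.Factorisation using (factorise)
open import Data.Nat.ListAction using (product)
open import Data.List using ([]; _∷_)
open import Data.List.Relation.Unary.All using (_∷_)
open import Data.Product using (∃-syntax; _,_; proj₂)
open import Data.Sum using (_⊎_; inj₁; inj₂; swap)
open import Data.Empty using (⊥; ⊥-elim)
open import Relation.Nullary using (¬_; yes; no)
open import Relation.Nullary.Decidable using (from-yes; from-no)
open import Relation.Binary.PropositionalEquality using (_≡_; refl; sym; trans; subst; ≢-sym)
open import Data.Nat.Solver using (module +-*-Solver)
open +-*-Solver using (solve; _:*_; _:+_; con; _:=_)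

prime⇒2≤ : ∀ {t} → Prime t → 2 ≤ t
prime⇒2≤ {t} t-prime = nonTrivial⇒n>1 t {{prime⇒nonTrivial t-prime}}

2≤m*n+1 : ∀ {m n} → 1 ≤ m → 1 ≤ n → 2 ≤ m * n + 1
2≤m*n+1 1≤m 1≤n = +-monoˡ-≤ 1 (*-mono-≤ 1≤m 1≤n)

∃-prime-divisor : ∀ {n} → 2 ≤ n → ∃[ s ] Prime s × s ∣ n
∃-prime-divisor {n} 2≤n with factorise n {{>-nonZero (≤-trans (s≤s z≤n) 2≤n)}}
... | record { factors = [] ; isFactorisation = n≡1 } = ⊥-elim (<⇒≢ 2≤n (sym n≡1))
... | record { factors = s ∷ ss ; isFactorisation = n≡s*ss ; factorsPrime = s-prime ∷ _ } =
  s , s-prime , divides (product ss) (trans n≡s*ss (*-comm s (product ss)))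

prime-divisor-of-prime : ∀ {t s} → Prime t → Prime s → s ∣ t → s ≡ t
prime-divisor-of-prime t-prime s-prime s∣t with prime⇒irreducible t-prime s∣t
... | inj₁ s≡1 = ⊥-elim (<⇒≢ (prime⇒2≤ s-prime) (sym s≡1))
... | inj₂ s≡t = s≡t

prime⇒square∤ : ∀ {t} → Prime t → ¬ t * t ∣ t
prime⇒square∤ {t} t-prime t*t∣t = <⇒≢ (prime⇒2≤ t-prime) (sym (∣1⇒≡1 t∣1))
  where
  instance _ = prime⇒nonZero t-prime
  t∣1 : t ∣ 1
  t∣1 = *-cancelˡ-∣ t (subst (t * t ∣_) (sym (*-identityʳ t)) t*t∣t)

prime∤-both-coprime : ∀ {m n s} → Coprime m n → Prime s → s ∣ m → s ∣ n → ⊥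
prime∤-both-coprime m⊥n s-prime s∣m s∣n =
  <⇒≢ (prime⇒2≤ s-prime) (sym (m⊥n (s∣m , s∣n)))

OnlyPrimeFactor : ℕ → ℕ → Set
OnlyPrimeFactor t n = ∀ s → Prime s → s ∣ n → s ≡ t

onlyPrimeFactor⇒∣ : ∀ {t n} → OnlyPrimeFactor t n → 2 ≤ n → t ∣ n
onlyPrimeFactor⇒∣ {t} {n} only 2≤n with ∃-prime-divisor 2≤n
... | s , s-prime , s∣n = subst (_∣ n) (only s s-prime s∣n) s∣n

onlyPrimeFactor⇒square∣ : ∀ {t n} → Prime t → OnlyPrimeFactor t n → t < n → t * t ∣ n
onlyPrimeFactor⇒square∣ {t} {n} t-prime only t<n
  with onlyPrimeFactor⇒∣ only (≤-trans (prime⇒2≤ t-prime) (<⇒≤ t<n))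
... | divides m n≡m*t = subst (t * t ∣_) (sym n≡m*t) (*-monoˡ-∣ t t∣m)
  where
  2≤m : 2 ≤ m
  2≤m with 2 ≤? m
  ... | yes 2≤m = 2≤m
  ... | no 2≰m = ⊥-elim (<⇒≱ t<n (begin
          n      ≡⟨ n≡m*t ⟩
          m * t  ≤⟨ *-monoˡ-≤ t (≤-pred (≰⇒> 2≰m)) ⟩
          1 * t  ≡⟨ *-identityˡ t ⟩
          t      ∎))
    where open ≤-Reasoning
  t∣m : t ∣ m
  t∣m = onlyPrimeFactor⇒∣ (λ s s-prime s∣m → only s s-prime (∣-trans s∣m (divides t (trans n≡m*t (*-comm m t))))) 2≤m

coprime-k*x+1-suc-k*x+1 : ∀ k x → Coprime (k * x + 1) (suc k * x + 1)
coprime-k*x+1-suc-k*x+1 k x {i} (i∣kx+1 , i∣k'x+1) =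
  ∣1⇒≡1 (∣m+n∣m⇒∣n (subst (i ∣_) identity (∣n⇒∣m*n (suc k) i∣kx+1)) (∣n⇒∣m*n k i∣k'x+1))
  where
  identity : suc k * (k * x + 1) ≡ k * (suc k * x + 1) + 1
  identity = solve 2 (λ k x → (con 1 :+ k) :* (k :* x :+ con 1) := k :* ((con 1 :+ k) :* x :+ con 1) :+ con 1) refl k x

∣β*c+1∧γ*d+1∧c*d+1⇒∣β*γ+1 : ∀ {t} β γ c d → t ∣ β * c + 1 → t ∣ γ * d + 1 → t ∣ c * d + 1 → t ∣ β * γ + 1
∣β*c+1∧γ*d+1∧c*d+1⇒∣β*γ+1 {t} β γ c d t∣u t∣v t∣w =
  ∣m+n∣m⇒∣n (subst (t ∣_) identity (∣m∣n⇒∣m+n (∣m∣n⇒∣m+n (∣n⇒∣m*n (β * γ) t∣w) t∣u) t∣v))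
            (∣m⇒∣m*n (γ * d + 1) t∣u)
  where
  identity : β * γ * (c * d + 1) + (β * c + 1) + (γ * d + 1) ≡ (β * c + 1) * (γ * d + 1) + (β * γ + 1)
  identity = solve 4 (λ β γ c d →
    β :* γ :* (c :* d :+ con 1) :+ (β :* c :+ con 1) :+ (γ :* d :+ con 1)
      := (β :* c :+ con 1) :* (γ :* d :+ con 1) :+ (β :* γ :+ con 1)) refl β γ c d

no-prime-power-triple : ∀ {t} β γ c d .{{_ : NonZero β}} .{{_ : NonZero γ}} →
  Prime t → t ≡ β * γ + 1 → γ < c → β < d →
  OnlyPrimeFactor t (β * c + 1) → OnlyPrimeFactor t (γ * d + 1) → OnlyPrimeFactor t (c * d + 1) → ⊥
no-prime-power-triple β γ c d t-prime refl γ<c β<d only-u only-v only-w =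
  prime⇒square∤ t-prime (∣β*c+1∧γ*d+1∧c*d+1⇒∣β*γ+1 β γ c d
    (square∣ only-u (*-monoʳ-< β γ<c))
    (square∣ only-v (subst (_< γ * d) (*-comm γ β) (*-monoʳ-< γ β<d)))
    (square∣ only-w (subst (_< c * d) (*-comm γ β) (*-mono-< γ<c β<d))))
  where
  square∣ : ∀ {m} → OnlyPrimeFactor (β * γ + 1) (m + 1) → β * γ < m → (β * γ + 1) * (β * γ + 1) ∣ m + 1
  square∣ only βγ<m = onlyPrimeFactor⇒square∣ t-prime only (+-monoˡ-< 1 βγ<m)

sUnit-swap : ∀ {p q n} → IsSUnit₂ p q n → IsSUnit₂ q p n
sUnit-swap (0<n , factors) = 0<n , λ s s-prime s∣n → swap (factors s s-prime s∣n)

sUnit∧∤⇒onlyPrimeFactor : ∀ {p q n} → IsSUnit₂ p q n → ¬ q ∣ n → OnlyPrimeFactor p n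
sUnit∧∤⇒onlyPrimeFactor (_ , factors) q∤n s s-prime s∣n with factors s s-prime s∣n
... | inj₁ s≡p = s≡p
... | inj₂ refl = ⊥-elim (q∤n s∣n)

coprime-sUnits-split : ∀ {p q m n} → IsSUnit₂ p q m → IsSUnit₂ p q n → 2 ≤ m → 2 ≤ n → Coprime m n →
  (OnlyPrimeFactor p m × OnlyPrimeFactor q n) ⊎ (OnlyPrimeFactor q m × OnlyPrimeFactor p n)
coprime-sUnits-split m-unit n-unit 2≤m 2≤n m⊥n
  with ∃-prime-divisor 2≤m | ∃-prime-divisor 2≤n
... | s , s-prime , s∣m | s′ , s′-prime , s′∣n
  with proj₂ m-unit s s-prime s∣m | proj₂ n-unit s′ s′-prime s′∣n
... | inj₁ refl | inj₂ refl =
  inj₁ ( sUnit∧∤⇒onlyPrimeFactor m-unit (λ s′∣m → prime∤-both-coprime m⊥n s′-prime s′∣m s′∣n)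
       , sUnit∧∤⇒onlyPrimeFactor (sUnit-swap n-unit) (prime∤-both-coprime m⊥n s-prime s∣m))
... | inj₂ refl | inj₁ refl =
  inj₂ ( sUnit∧∤⇒onlyPrimeFactor (sUnit-swap m-unit) (λ s′∣m → prime∤-both-coprime m⊥n s′-prime s′∣m s′∣n)
       , sUnit∧∤⇒onlyPrimeFactor n-unit (prime∤-both-coprime m⊥n s-prime s∣m))
... | inj₁ refl | inj₁ refl = ⊥-elim (prime∤-both-coprime m⊥n s-prime s∣m s′∣n)
... | inj₂ refl | inj₂ refl = ⊥-elim (prime∤-both-coprime m⊥n s-prime s∣m s′∣n)

-- Shifted values are written β * x + 1 rather than x + 1, to match a * x + 1 for a ∈ {1, 2}.
sUnits-x+1-2x+1-split : ∀ {p q x} → 1 ≤ x → IsSUnit₂ p q (1 * x + 1) → IsSUnit₂ p q (2 * x + 1) →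
  (OnlyPrimeFactor p (1 * x + 1) × OnlyPrimeFactor q (2 * x + 1)) ⊎
  (OnlyPrimeFactor q (1 * x + 1) × OnlyPrimeFactor p (2 * x + 1))
sUnits-x+1-2x+1-split {x = x} 1≤x u v =
  coprime-sUnits-split u v (2≤m*n+1 {1} ≤-refl 1≤x) (2≤m*n+1 {2} (s≤s z≤n) 1≤x) (coprime-k*x+1-suc-k*x+1 1 x)

module _ {r : ℕ} (r-prime : Prime r) (r≢3 : r ≢ 3) {c d : ℕ} (3≤c : 3 ≤ c) (3≤d : 3 ≤ d)
         (cd+1-unit : IsSUnit₂ 3 r (c * d + 1)) where

  private
    1≤c : 1 ≤ c
    1≤c = ≤-trans (s≤s z≤n) 3≤c
    1≤d : 1 ≤ d
    1≤d = ≤-trans (s≤s z≤n) 3≤d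
    ∣β*c+1 : ∀ {t} β → 1 ≤ β → OnlyPrimeFactor t (β * c + 1) → t ∣ β * c + 1
    ∣β*c+1 β 1≤β only = onlyPrimeFactor⇒∣ only (2≤m*n+1 1≤β 1≤c)
    ∣γ*d+1 : ∀ {t} γ → 1 ≤ γ → OnlyPrimeFactor t (γ * d + 1) → t ∣ γ * d + 1
    ∣γ*d+1 γ 1≤γ only = onlyPrimeFactor⇒∣ only (2≤m*n+1 1≤γ 1≤d)
    ∣c*d+1 : ∀ {t} → OnlyPrimeFactor t (c * d + 1) → t ∣ c * d + 1
    ∣c*d+1 only = onlyPrimeFactor⇒∣ only (2≤m*n+1 1≤c 1≤d)

  no-case-3∣c+1-3∣d+1 : OnlyPrimeFactor 3 (1 * c + 1) → OnlyPrimeFactor r (2 * c + 1) →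
                         OnlyPrimeFactor 3 (1 * d + 1) → OnlyPrimeFactor r (2 * d + 1) → ⊥
  no-case-3∣c+1-3∣d+1 only3-c onlyr-c only3-d onlyr-d = no-prime-power-triple 2 2 c d r-prime r≡5 3≤c 3≤d onlyr-c onlyr-d onlyr-cd
    where
    onlyr-cd : OnlyPrimeFactor r (c * d + 1)
    onlyr-cd = sUnit∧∤⇒onlyPrimeFactor (sUnit-swap cd+1-unit) λ 3∣cd+1 → from-no (3 ∣? 2)
      (∣β*c+1∧γ*d+1∧c*d+1⇒∣β*γ+1 1 1 c d (∣β*c+1 1 ≤-refl only3-c) (∣γ*d+1 1 ≤-refl only3-d) 3∣cd+1)
    r≡5 : r ≡ 2 * 2 + 1
    r≡5 = prime-divisor-of-prime (from-yes (prime? 5)) r-prime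
      (∣β*c+1∧γ*d+1∧c*d+1⇒∣β*γ+1 2 2 c d (∣β*c+1 2 (s≤s z≤n) onlyr-c) (∣γ*d+1 2 (s≤s z≤n) onlyr-d) (∣c*d+1 onlyr-cd))

  no-case-3∣2c+1-3∣2d+1 : OnlyPrimeFactor r (1 * c + 1) → OnlyPrimeFactor 3 (2 * c + 1) →
                           OnlyPrimeFactor r (1 * d + 1) → OnlyPrimeFactor 3 (2 * d + 1) → ⊥
  no-case-3∣2c+1-3∣2d+1 onlyr-c only3-c onlyr-d only3-d =
    no-prime-power-triple 1 1 c d r-prime r≡2 (<⇒≤ 3≤c) (<⇒≤ 3≤d) onlyr-c onlyr-d onlyr-cd
    where
    onlyr-cd : OnlyPrimeFactor r (c * d + 1)
    onlyr-cd = sUnit∧∤⇒onlyPrimeFactor (sUnit-swap cd+1-unit) λ 3∣cd+1 → from-no (3 ∣? 5)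
      (∣β*c+1∧γ*d+1∧c*d+1⇒∣β*γ+1 2 2 c d (∣β*c+1 2 (s≤s z≤n) only3-c) (∣γ*d+1 2 (s≤s z≤n) only3-d) 3∣cd+1)
    r≡2 : r ≡ 1 * 1 + 1
    r≡2 = prime-divisor-of-prime (from-yes (prime? 2)) r-prime
      (∣β*c+1∧γ*d+1∧c*d+1⇒∣β*γ+1 1 1 c d (∣β*c+1 1 ≤-refl onlyr-c) (∣γ*d+1 1 ≤-refl onlyr-d) (∣c*d+1 onlyr-cd))

  no-case-3∣c+1-3∣2d+1 : OnlyPrimeFactor 3 (1 * c + 1) → OnlyPrimeFactor r (2 * c + 1) →
                          OnlyPrimeFactor r (1 * d + 1) → OnlyPrimeFactor 3 (2 * d + 1) → ⊥
  no-case-3∣c+1-3∣2d+1 only3-c onlyr-c onlyr-d only3-d =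
    no-prime-power-triple 1 2 c d (from-yes (prime? 3)) refl 3≤c (<⇒≤ 3≤d) only3-c only3-d only3-cd
    where
    only3-cd : OnlyPrimeFactor 3 (c * d + 1)
    only3-cd = sUnit∧∤⇒onlyPrimeFactor cd+1-unit λ r∣cd+1 → r≢3 (prime-divisor-of-prime (from-yes (prime? 3)) r-prime
      (∣β*c+1∧γ*d+1∧c*d+1⇒∣β*γ+1 2 1 c d (∣β*c+1 2 (s≤s z≤n) onlyr-c) (∣γ*d+1 1 ≤-refl onlyr-d) r∣cd+1))

1,2-not-extendable : ∀ {r c d} → Prime r → r ≢ 3 → 3 ≤ c → 3 ≤ d →
  IsSUnit₂ 3 r (1 * c + 1) → IsSUnit₂ 3 r (1 * d + 1) →
  IsSUnit₂ 3 r (2 * c + 1) → IsSUnit₂ 3 r (2 * d + 1) → IsSUnit₂ 3 r (c * d + 1) → ⊥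
1,2-not-extendable {r} {c} {d} r-prime r≢3 3≤c 3≤d c+1 d+1 2c+1 2d+1 cd+1
  with sUnits-x+1-2x+1-split {3} {r} (<⇒≤ (<⇒≤ 3≤c)) c+1 2c+1 | sUnits-x+1-2x+1-split {3} {r} (<⇒≤ (<⇒≤ 3≤d)) d+1 2d+1
... | inj₁ (only3-c , onlyr-c) | inj₁ (only3-d , onlyr-d) = no-case-3∣c+1-3∣d+1 r-prime r≢3 3≤c 3≤d cd+1 only3-c onlyr-c only3-d onlyr-d
... | inj₂ (onlyr-c , only3-c) | inj₂ (onlyr-d , only3-d) = no-case-3∣2c+1-3∣2d+1 r-prime r≢3 3≤c 3≤d cd+1 onlyr-c only3-c onlyr-d only3-d
... | inj₁ (only3-c , onlyr-c) | inj₂ (onlyr-d , only3-d) = no-case-3∣c+1-3∣2d+1 r-prime r≢3 3≤c 3≤d cd+1 only3-c onlyr-c onlyr-d only3-d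
... | inj₂ (onlyr-c , only3-c) | inj₁ (only3-d , onlyr-d) = no-case-3∣c+1-3∣2d+1 r-prime r≢3 3≤d 3≤c dc+1 only3-d onlyr-d onlyr-c only3-c
  where
  dc+1 : IsSUnit₂ 3 r (d * c + 1)
  dc+1 = subst (λ n → IsSUnit₂ 3 r (n + 1)) (*-comm c d) cd+1

0<m<n∧m*n<3⇒m≡1∧n≡2 : ∀ {m n} → 0 < m → m < n → m * n < 3 → m ≡ 1 × n ≡ 2
0<m<n∧m*n<3⇒m≡1∧n≡2 {1}                   {2}                   _ _ _ = refl , refl
0<m<n∧m*n<3⇒m≡1∧n≡2 {1}                   {suc (suc (suc _))}   _ _ (s≤s (s≤s (s≤s ())))
0<m<n∧m*n<3⇒m≡1∧n≡2 {suc (suc _)}         {suc (suc (suc _))}   _ _ (s≤s (s≤s (s≤s ())))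
0<m<n∧m*n<3⇒m≡1∧n≡2 {1}                   {1}                   _ (s≤s ()) _
0<m<n∧m*n<3⇒m≡1∧n≡2 {suc (suc _)}         {1}                   _ (s≤s ()) _
0<m<n∧m*n<3⇒m≡1∧n≡2 {suc (suc _)}         {2}                   _ (s≤s (s≤s ())) _

a*b≥3 : ∀ {p q a b c d} → Prime p → Prime q → p ≢ q → IsSDiophantineQuadruple₂ p q a b c d →
        a < b → b < c → c < d → a * b ≥ 3
a*b≥3 {a = a} {b} p-prime q-prime p≢q ((0<a , _) , _ , ab+1 , ac+1 , ad+1 , bc+1 , bd+1 , cd+1) a<b b<c c<d
  with 3 ≤? a * b
... | yes 3≤ab = 3≤ab
... | no 3≰ab with 0<m<n∧m*n<3⇒m≡1∧n≡2 0<a a<b (≰⇒> 3≰ab)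
... | refl , refl with proj₂ ab+1 3 (from-yes (prime? 3)) ∣-refl
... | inj₁ refl = ⊥-elim (1,2-not-extendable q-prime (≢-sym p≢q) b<c (≤-trans b<c (<⇒≤ c<d))
                    ac+1 ad+1 bc+1 bd+1 cd+1)
... | inj₂ refl = ⊥-elim (1,2-not-extendable p-prime p≢q b<c (≤-trans b<c (<⇒≤ c<d))
                    (sUnit-swap ac+1) (sUnit-swap ad+1) (sUnit-swap bc+1) (sUnit-swap bd+1) (sUnit-swap cd+1))

no-three-distinct-in-pair : ∀ {A : Set} {p q x y z : A} → x ≢ y → x ≢ z → y ≢ z →
  x ≡ p ⊎ x ≡ q → y ≡ p ⊎ y ≡ q → z ≡ p ⊎ z ≡ q → ⊥
no-three-distinct-in-pair x≢y _ _ (inj₁ refl) (inj₁ refl) _ = x≢y refl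
no-three-distinct-in-pair x≢y _ _ (inj₂ refl) (inj₂ refl) _ = x≢y refl
no-three-distinct-in-pair _ x≢z _ (inj₁ refl) _ (inj₁ refl) = x≢z refl
no-three-distinct-in-pair _ x≢z _ (inj₂ refl) _ (inj₂ refl) = x≢z refl
no-three-distinct-in-pair _ _ y≢z _ (inj₁ refl) (inj₁ refl) = y≢z refl
no-three-distinct-in-pair _ _ y≢z _ (inj₂ refl) (inj₂ refl) = y≢z refl

no-sDiophantine-triple-a-3-4 : ∀ {p q} a → 0 < a → a < 3 →
  IsSUnit₂ p q (a * 3 + 1) → IsSUnit₂ p q (a * 4 + 1) → IsSUnit₂ p q (3 * 4 + 1) → ⊥
no-sDiophantine-triple-a-3-4 1 _ _ (_ , 4-factors) (_ , 5-factors) (_ , 13-factors) =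
  no-three-distinct-in-pair (λ ()) (λ ()) (λ ())
    (4-factors 2 (from-yes (prime? 2)) (divides 2 refl))
    (5-factors 5 (from-yes (prime? 5)) ∣-refl)
    (13-factors 13 (from-yes (prime? 13)) ∣-refl)
no-sDiophantine-triple-a-3-4 2 _ _ (_ , 7-factors) (_ , 9-factors) (_ , 13-factors) =
  no-three-distinct-in-pair (λ ()) (λ ()) (λ ())
    (7-factors 7 (from-yes (prime? 7)) ∣-refl)
    (9-factors 3 (from-yes (prime? 3)) (divides 3 refl))
    (13-factors 13 (from-yes (prime? 13)) ∣-refl)
no-sDiophantine-triple-a-3-4 (suc (suc (suc _))) _ (s≤s (s≤s (s≤s ()))) _ _ _

a<b<c<5∧a*b≥3⇒b≡3∧c≡4 : ∀ {a b c} → a < b → b < c → c < 5 → a * b ≥ 3 → b ≡ 3 × c ≡ 4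
a<b<c<5∧a*b≥3⇒b≡3∧c≡4 {a} {b} {c} a<b b<c c<5 3≤ab = b≡3 , c≡4
  where
  3≤b : 3 ≤ b
  3≤b with 3 ≤? b
  ... | yes 3≤b = 3≤b
  ... | no 3≰b = ⊥-elim (<⇒≱ 3≤ab (*-mono-≤ {a} {1} {b} {2} (≤-pred (≤-trans a<b b≤2)) b≤2))
    where
    b≤2 : b ≤ 2
    b≤2 = ≤-pred (≰⇒> 3≰b)
  c≡4 : c ≡ 4
  c≡4 = ≤-antisym (≤-pred c<5) (≤-trans (s≤s 3≤b) b<c)
  b≡3 : b ≡ 3
  b≡3 = ≤-antisym (≤-pred (subst (b <_) c≡4 b<c)) 3≤b

c≥5 : ∀ {p q a b c d} → IsSDiophantineQuadruple₂ p q a b c d → a < b → b < c → a * b ≥ 3 → c ≥ 5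
c≥5 {a = a} {c = c} ((0<a , _) , _ , ab+1 , ac+1 , _ , bc+1 , _) a<b b<c 3≤ab with 5 ≤? c
... | yes 5≤c = 5≤c
... | no 5≰c with a<b<c<5∧a*b≥3⇒b≡3∧c≡4 a<b b<c (≰⇒> 5≰c) 3≤ab
... | refl , refl = ⊥-elim (no-sDiophantine-triple-a-3-4 a 0<a a<b ab+1 ac+1 bc+1)

lemma7 : (p q : ℕ) → Prime p → Prime q → p ≢ q →
         (a b c d : ℕ) → IsSDiophantineQuadruple₂ p q a b c d →
         a < b → b < c → c < d →
         (a * b ≥ 3) × (c ≥ 5)
lemma7 p q p-prime q-prime p≢q a b c d quadruple a<b b<c c<d = 3≤ab , c≥5 quadruple a<b b<c 3≤ab
  where
  3≤ab : a * b ≥ 3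
  3≤ab = a*b≥3 p-prime q-prime p≢q quadruple a<b b<c c<d
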